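{- Let $D=(V,E)$ be a finite digraph, $r\in V$, $v\in V-r$ and $x\in\mathbb{R}_+^E$. Let $z\leq x$ be an $r\to v$ flow of amount $\lambda_x(v)$, and define $y\in\mathbb{R}_+^E$ by $y(e):=z(e)$ if $e\in\mathsf{in}_D(v)$ and $y(e):=x(e)$ otherwise. Then $\lambda_y(u)=\lambda_x(u)$ for every $u\in V-r$.
   Context: $\mathsf{in}_D(U)$ and $\mathsf{out}_D(U)$ denote the sets of edges entering, resp. leaving, $U\subseteq V$, and $\mathsf{in}_D(v)=\mathsf{in}_D(\{v\})$. For $w\in\mathbb{R}_+^E$, $\varrho_w(U):=\sum_{e\in\mathsf{in}_D(U)}w(e)$, $\delta_w(U):=\sum_{e\in\mathsf{out}_D(U)}w(e)$; $\leq$ is coordinatewise. For $v\in V-r$, $w$ is an $r\to v$ flow if $\varrho_w(t)=\delta_w(t)$ for all $t\in V\setminus\{r,v\}$ and $\varrho_w(r)=\delta_w(v)=0$; its amount is $\delta_w(r)$. For $c\in\mathbb{R}_+^E$ and $u\in V-r$, $\lambda_c(u):=\max\{\delta_w(r): w \text{ an } r\to u \text{ flow with } w\leq c\}$. -}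

module Defs where

open import Level using (Level; _⊔_) renaming (suc to lsuc)
open import Data.Nat using (ℕ)
open import Data.Fin using (Fin; _≟_)
open import Data.Bool using (Bool; true; false; if_then_else_; _∧_; not)
open import Data.Product using (Σ; ∃; _×_; _,_)
open import Relation.Nullary using (¬_)
open import Relation.Nullary.Decidable using (⌊_⌋)
open import Relation.Binary.PropositionalEquality using (_≡_)
open import Relation.Binary.Structures using (IsTotalOrder)
open import Algebra.Structures using (IsCommutativeRing)
open import Algebra.Bundles using (CommutativeMonoid)
import Algebra.Properties.CommutativeMonoid.Sum as Sum

-- An ordered field (the paper works over ℝ, which is one instance).
record OrderedField (c ℓ₁ ℓ₂ : Level) : Set (lsuc (c ⊔ ℓ₁ ⊔ ℓ₂)) where
  infixl 6 _+_
  infixl 7 _*_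
  infix 4 _≈_ _≤_
  field
    Carrier : Set c
    _≈_ : Carrier → Carrier → Set ℓ₁
    _≤_ : Carrier → Carrier → Set ℓ₂
    _+_ : Carrier → Carrier → Carrier
    _*_ : Carrier → Carrier → Carrier
    -_  : Carrier → Carrier
    0#  : Carrier
    1#  : Carrier
    isCommutativeRing : IsCommutativeRing _≈_ _+_ _*_ -_ 0# 1#
    isTotalOrder      : IsTotalOrder _≈_ _≤_
    0≉1     : ¬ (0# ≈ 1#)
    inverse : ∀ x → ¬ (x ≈ 0#) → ∃ λ y → x * y ≈ 1#
    +-monoˡ-≤ : ∀ {x y} z → x ≤ y → x + z ≤ y + z
    *-nonneg  : ∀ {x y} → 0# ≤ x → 0# ≤ y → 0# ≤ x * y

  +-commutativeMonoid : CommutativeMonoid c ℓ₁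
  +-commutativeMonoid = record
    { isCommutativeMonoid = IsCommutativeRing.+-isCommutativeMonoid isCommutativeRing }

record Digraph : Set where
  field
    n : ℕ
    m : ℕ
    tail : Fin m → Fin n
    head : Fin m → Fin n

module FlowDefs {c ℓ₁ ℓ₂ : Level} (F : OrderedField c ℓ₁ ℓ₂) (D : Digraph) where
  open OrderedField F
  open Digraph D
  open Sum +-commutativeMonoid using (sum)

  Vertex : Set
  Vertex = Fin n

  Edge : Set
  Edge = Fin m

  Weight : Set c
  Weight = Edge → Carrier

  Nonneg : Weight → Set ℓ₂
  Nonneg w = ∀ e → 0# ≤ w e

  _≤ᵥ_ : Weight → Weight → Set ℓ₂
  w ≤ᵥ w' = ∀ e → w e ≤ w' e

  Subset : Set
  Subset = Vertex → Bool

  ⟦_⟧ : Vertex → Subset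
  ⟦ v ⟧ t = ⌊ v ≟ t ⌋

  enters : Subset → Edge → Bool
  enters U e = U (head e) ∧ not (U (tail e))

  leaves : Subset → Edge → Bool
  leaves U e = U (tail e) ∧ not (U (head e))

  ϱ : Weight → Subset → Carrier
  ϱ w U = sum (λ e → if enters U e then w e else 0#)

  δ : Weight → Subset → Carrier
  δ w U = sum (λ e → if leaves U e then w e else 0#)

  IsFlow : Vertex → Vertex → Weight → Set (ℓ₁ ⊔ ℓ₂)
  IsFlow r v w =
    Nonneg w
    × (∀ t → ¬ (t ≡ r) → ¬ (t ≡ v) → ϱ w ⟦ t ⟧ ≈ δ w ⟦ t ⟧)
    × ϱ w ⟦ r ⟧ ≈ 0#
    × δ w ⟦ v ⟧ ≈ 0#

  amount : Vertex → Weight → Carrier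
  amount r w = δ w ⟦ r ⟧

  IsMaxFlowValue : Vertex → Weight → Vertex → Carrier → Set (c ⊔ ℓ₁ ⊔ ℓ₂)
  IsMaxFlowValue r cap u μ =
    (∃ λ w → IsFlow r u w × w ≤ᵥ cap × amount r w ≈ μ)
    × (∀ w → IsFlow r u w → w ≤ᵥ cap → amount r w ≤ μ)

  restrictIn : Vertex → Weight → Weight → Weight
  restrictIn v z x e = if enters ⟦ v ⟧ e then z e else x e

module Submission where

-- As y ≤ x, the content is that every x-bounded r → u flow w has the amount of
-- some y-bounded flow; by max-flow min-cut, that every r-u cut X has
-- y-capacity at least amount(w).  If v ∉ X, y equals x on the edges entering X
-- and weak duality applies.  If v ∈ X, take a minimum r-v cut T for x, so
-- ϱx(T) ≤ amount(z) as z is maximum; weak duality for w on X ∪ T and for z ≤ y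
-- on X ∩ T, with ϱx(X ∪ T) + ϱy(X ∩ T) ≤ ϱy(X) + ϱx(T), gives the bound.

open import Defs
open import Level using (Level; _⊔_)
open import Data.Bool using (Bool; true; false; if_then_else_; _∧_; _∨_; not)
open import Data.Bool.Properties using (∧-zeroʳ; ∨-zeroʳ)
open import Data.Empty using (⊥-elim)
open import Data.Fin using (Fin; zero; suc; _≟_)
open import Data.Fin.Properties using (suc-injective)
open import Data.Nat using (zero; suc)
open import Data.List using (List; []; _∷_; allFin)
open import Data.List.Membership.Propositional using (_∈_)
open import Data.List.Membership.Propositional.Properties using (∈-allFin)
open import Data.List.Relation.Unary.Any using (here; there)
open import Data.Product using (Σ; _×_; _,_; proj₁; proj₂)
open import Data.Sum using (_⊎_; inj₁; inj₂; [_,_]′)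
open import Function using (_∘_)
open import Function.Bundles using (_⇔_; mk⇔)
open import Relation.Nullary using (¬_; yes; no)
open import Relation.Nullary.Decidable using (⌊_⌋)
open import Relation.Binary.Bundles using (Poset)
open import Relation.Binary.Structures using (IsTotalOrder)
open import Relation.Binary.PropositionalEquality as ≡ using (_≡_; _≗_)
import Relation.Binary.Construct.Flip.EqAndOrd as Flip
import Relation.Binary.Reasoning.PartialOrder as PosetReasoning
open import Algebra.Bundles using (CommutativeRing)
open import Algebra.Structures using (IsCommutativeRing)
import Algebra.Properties.AbelianGroup as AbelianGroupProperties
import Algebra.Properties.CommutativeMonoid.Sum as SumProperties
import Algebra.Solver.CommutativeMonoid as CommutativeMonoidSolver

module Maximise {a ℓ₁ ℓ₂} {A : Set a} {_≈_ : A → A → Set ℓ₁} {_≤_ : A → A → Set ℓ₂}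
                (isTotalOrder : IsTotalOrder _≈_ _≤_) where
  open IsTotalOrder isTotalOrder

  Respects≗ : ∀ {k} → ((Fin k → Bool) → A) → Set ℓ₁
  Respects≗ h = ∀ X Y → X ≗ Y → h X ≈ h Y

  _◃_ : ∀ {k} → Bool → (Fin k → Bool) → Fin (suc k) → Bool
  (b ◃ X) zero    = b
  (b ◃ X) (suc i) = X i

  ◃-resp : ∀ {k} b {X Y : Fin k → Bool} → X ≗ Y → (b ◃ X) ≗ (b ◃ Y)
  ◃-resp b eq zero    = ≡.refl
  ◃-resp b eq (suc i) = eq i

  ◃-η : ∀ {k} (Y : Fin (suc k) → Bool) → Y ≗ (Y zero ◃ (λ i → Y (suc i)))
  ◃-η Y zero    = ≡.refl
  ◃-η Y (suc i) = ≡.refl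

  -- By induction on k: maximise separately over the subsets without and with 0.
  argmax : ∀ k (h : (Fin k → Bool) → A) → Respects≗ h →
           Σ (Fin k → Bool) λ X → ∀ Y → h Y ≤ h X
  argmax zero    h resp = (λ ()) , λ Y → reflexive (resp Y (λ ()) (λ ()))
  argmax (suc k) h resp = better (total (h (false ◃ X₀)) (h (true ◃ X₁)))
    where
    max₀ : Σ (Fin k → Bool) λ X → ∀ Y → h (false ◃ Y) ≤ h (false ◃ X)
    max₀ = argmax k (λ Y → h (false ◃ Y)) (λ X Y eq → resp _ _ (◃-resp false eq))

    max₁ : Σ (Fin k → Bool) λ X → ∀ Y → h (true ◃ Y) ≤ h (true ◃ X)
    max₁ = argmax k (λ Y → h (true ◃ Y)) (λ X Y eq → resp _ _ (◃-resp true eq))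

    X₀ X₁ : Fin k → Bool
    X₀ = proj₁ max₀
    X₁ = proj₁ max₁

    dominated : ∀ Y → (h Y ≤ h (false ◃ X₀)) ⊎ (h Y ≤ h (true ◃ X₁))
    dominated Y = byHead (Y zero) (resp _ _ (◃-η Y))
      where
      rest : Fin k → Bool
      rest i = Y (suc i)
      byHead : ∀ b → h Y ≈ h (b ◃ rest) → (h Y ≤ h (false ◃ X₀)) ⊎ (h Y ≤ h (true ◃ X₁))
      byHead false eq = inj₁ (trans (reflexive eq) (proj₂ max₀ rest))
      byHead true  eq = inj₂ (trans (reflexive eq) (proj₂ max₁ rest))

    better : (h (false ◃ X₀) ≤ h (true ◃ X₁)) ⊎ (h (true ◃ X₁) ≤ h (false ◃ X₀)) →
             Σ (Fin (suc k) → Bool) λ X → ∀ Y → h Y ≤ h X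
    better (inj₁ le) = (true ◃ X₁) , λ Y → [ (λ p → trans p le) , (λ p → p) ]′ (dominated Y)
    better (inj₂ le) = (false ◃ X₀) , λ Y → [ (λ p → p) , (λ p → trans p le) ]′ (dominated Y)

module OrderedFieldFacts {c ℓ₁ ℓ₂ : Level} (F : OrderedField c ℓ₁ ℓ₂) where
  open OrderedField F
  open IsCommutativeRing isCommutativeRing public
    using (+-cong; +-congˡ; +-congʳ; +-comm; +-assoc; +-identityˡ; +-identityʳ;
           -‿cong; -‿inverseˡ; -‿inverseʳ; _-_)
    renaming (refl to ≈-refl; sym to ≈-sym; trans to ≈-trans; reflexive to ≡⇒≈)
  open IsTotalOrder isTotalOrder public
    using (antisym; reflexive)
    renaming (refl to ≤-refl; trans to ≤-trans)

  commutativeRing : CommutativeRing c ℓ₁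
  commutativeRing = record { isCommutativeRing = isCommutativeRing }

  open AbelianGroupProperties (CommutativeRing.+-abelianGroup commutativeRing)
    using (⁻¹-∙-comm; ε⁻¹≈ε; ⁻¹-involutive; ⁻¹-injective; x∙y⁻¹≈ε⇒x≈y)
  open CommutativeMonoidSolver +-commutativeMonoid using (solve; _⊕_; _⊜_)
  open SumProperties +-commutativeMonoid public
    using (sum; sum-cong-≋; ∑-distrib-+; ∑-comm)

  poset : Poset c ℓ₁ ℓ₂
  poset = record { isPartialOrder = IsTotalOrder.isPartialOrder isTotalOrder }
  open PosetReasoning poset public

  -0≈0 : - 0# ≈ 0#
  -0≈0 = ε⁻¹≈ε

  -‿involutive : ∀ a → - - a ≈ a
  -‿involutive = ⁻¹-involutive

  -‿injective : ∀ {a b} → - a ≈ - b → a ≈ b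
  -‿injective = ⁻¹-injective

  x-0≈x : ∀ a → a - 0# ≈ a
  x-0≈x a = ≈-trans (+-congˡ -0≈0) (+-identityʳ a)

  x-x≈0 : ∀ a → a - a ≈ 0#
  x-x≈0 = -‿inverseʳ

  x+y-y≈x : ∀ a b → a + b - b ≈ a
  x+y-y≈x a b = begin-equality
    a + b - b     ≈⟨ +-assoc a b (- b) ⟩
    a + (b - b)   ≈⟨ +-congˡ (x-x≈0 b) ⟩
    a + 0#        ≈⟨ +-identityʳ a ⟩
    a             ∎

  x-y+y≈x : ∀ a b → a - b + b ≈ a
  x-y+y≈x a b = begin-equality
    a - b + b     ≈⟨ +-assoc a (- b) b ⟩
    a + (- b + b) ≈⟨ +-congˡ (-‿inverseˡ b) ⟩
    a + 0#        ≈⟨ +-identityʳ a ⟩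
    a             ∎

  -‿+ : ∀ a b → - (a + b) ≈ - a + - b
  -‿+ a b = ≈-sym (⁻¹-∙-comm a b)

  x-y≈0⇒x≈y : ∀ {a b} → a - b ≈ 0# → a ≈ b
  x-y≈0⇒x≈y {a} {b} = x∙y⁻¹≈ε⇒x≈y a b

  x+y≈0⇒y≈-x : ∀ {a b} → a + b ≈ 0# → b ≈ - a
  x+y≈0⇒y≈-x {a} {b} p = begin-equality
    b             ≈⟨ +-identityˡ b ⟨
    0# + b        ≈⟨ +-congʳ (-‿inverseˡ a) ⟨
    - a + a + b   ≈⟨ +-assoc (- a) a b ⟩
    - a + (a + b) ≈⟨ +-congˡ p ⟩
    - a + 0#      ≈⟨ +-identityʳ (- a) ⟩
    - a           ∎

  [x+y]-[z+w]≈[x-z]+[y-w] : ∀ a b d e → (a + b) - (d + e) ≈ (a - d) + (b - e)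
  [x+y]-[z+w]≈[x-z]+[y-w] a b d e = begin-equality
    (a + b) + - (d + e)     ≈⟨ +-congˡ (-‿+ d e) ⟩
    (a + b) + (- d + - e)   ≈⟨ solve 4 (λ x y z w → (x ⊕ y) ⊕ (z ⊕ w) ⊜ (x ⊕ z) ⊕ (y ⊕ w))
                                      ≈-refl a b (- d) (- e) ⟩
    (a - d) + (b - e)       ∎

  x+[y-z]+[z-y]≈x : ∀ a b d → a + (b - d) + (d - b) ≈ a
  x+[y-z]+[z-y]≈x a b d = begin-equality
    a + (b - d) + (d - b)   ≈⟨ solve 5 (λ x y z w v → (x ⊕ (y ⊕ z)) ⊕ (w ⊕ v)
                                                 ⊜ x ⊕ ((y ⊕ v) ⊕ (w ⊕ z)))
                                      ≈-refl a b (- d) d (- b) ⟩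
    a + ((b - b) + (d - d)) ≈⟨ +-congˡ (+-cong (x-x≈0 b) (x-x≈0 d)) ⟩
    a + (0# + 0#)           ≈⟨ +-congˡ (+-identityʳ 0#) ⟩
    a + 0#                  ≈⟨ +-identityʳ a ⟩
    a                       ∎

  +-monoʳ-≤ : ∀ {a b} d → a ≤ b → d + a ≤ d + b
  +-monoʳ-≤ {a} {b} d p = begin
    d + a ≈⟨ +-comm d a ⟩ a + d ≤⟨ +-monoˡ-≤ d p ⟩ b + d ≈⟨ +-comm b d ⟩ d + b ∎

  +-mono-≤ : ∀ {a b d e} → a ≤ b → d ≤ e → a + d ≤ b + e
  +-mono-≤ {a} {b} {d} p q = ≤-trans (+-monoˡ-≤ d p) (+-monoʳ-≤ b q)

  x≤y+z⇒x-z≤y : ∀ {a b d} → a ≤ b + d → a - d ≤ b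
  x≤y+z⇒x-z≤y {a} {b} {d} p = begin
    a - d ≤⟨ +-monoˡ-≤ (- d) p ⟩ b + d - d ≈⟨ x+y-y≈x b d ⟩ b ∎

  x-z≤y⇒x≤y+z : ∀ {a b d} → a - d ≤ b → a ≤ b + d
  x-z≤y⇒x≤y+z {a} {b} {d} p = begin
    a ≈⟨ x-y+y≈x a d ⟨ a - d + d ≤⟨ +-monoˡ-≤ d p ⟩ b + d ∎

  x+y≤z+w⇒y+[x-z]≤w : ∀ {a b d e} → a + b ≤ d + e → b + (a - d) ≤ e
  x+y≤z+w⇒y+[x-z]≤w {a} {b} {d} {e} p = begin
    b + (a - d)   ≈⟨ solve 3 (λ x y z → y ⊕ (x ⊕ z) ⊜ (x ⊕ y) ⊕ z) ≈-refl a b (- d) ⟩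
    (a + b) - d   ≤⟨ +-monoˡ-≤ (- d) p ⟩
    (d + e) - d   ≈⟨ +-congʳ (+-comm d e) ⟩
    (e + d) - d   ≈⟨ x+y-y≈x e d ⟩
    e             ∎

  +-cancelʳ-≤ : ∀ {a b} d → a + d ≤ b + d → a ≤ b
  +-cancelʳ-≤ {a} d p = ≤-trans (reflexive (≈-sym (x+y-y≈x a d))) (x≤y+z⇒x-z≤y p)

  nonneg-+ : ∀ {a b} → 0# ≤ a → 0# ≤ b → 0# ≤ a + b
  nonneg-+ {a} {b} p q = begin 0# ≈⟨ +-identityʳ 0# ⟨ 0# + 0# ≤⟨ +-mono-≤ p q ⟩ a + b ∎

  -‿anti-≤ : ∀ {a b} → a ≤ b → - b ≤ - a
  -‿anti-≤ {a} {b} p = begin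
    - b             ≈⟨ +-identityˡ (- b) ⟨
    0# + - b        ≈⟨ +-congʳ (x-x≈0 a) ⟨
    a - a + - b     ≤⟨ +-monoˡ-≤ (- b) (+-monoˡ-≤ (- a) p) ⟩
    b - a + - b     ≈⟨ solve 3 (λ x y z → (x ⊕ y) ⊕ z ⊜ y ⊕ (x ⊕ z)) ≈-refl b (- a) (- b) ⟩
    - a + (b - b)   ≈⟨ +-congˡ (x-x≈0 b) ⟩
    - a + 0#        ≈⟨ +-identityʳ (- a) ⟩
    - a             ∎

  -‿anti-≤⁻ : ∀ {a b} → - a ≤ - b → b ≤ a
  -‿anti-≤⁻ {a} {b} p = begin
    b ≈⟨ -‿involutive b ⟨ - - b ≤⟨ -‿anti-≤ p ⟩ - - a ≈⟨ -‿involutive a ⟩ a ∎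

  nonneg⇒-≤0 : ∀ {a} → 0# ≤ a → - a ≤ 0#
  nonneg⇒-≤0 p = ≤-trans (-‿anti-≤ p) (reflexive -0≈0)

  x-nonneg≤x : ∀ {a d} → 0# ≤ d → a - d ≤ a
  x-nonneg≤x {a} {d} p = begin
    a - d ≤⟨ +-monoʳ-≤ a (nonneg⇒-≤0 p) ⟩ a + 0# ≈⟨ +-identityʳ a ⟩ a ∎

  mask : Bool → Carrier → Carrier
  mask b a = if b then a else 0#

  mask-true : ∀ {b} a → b ≡ true → mask b a ≈ a
  mask-true a ≡.refl = ≈-refl

  mask-false : ∀ {b} a → b ≡ false → mask b a ≈ 0#
  mask-false a ≡.refl = ≈-refl

  mask-cong : ∀ b {a a'} → a ≈ a' → mask b a ≈ mask b a'
  mask-cong true  p = p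
  mask-cong false p = ≈-refl

  mask-0 : ∀ b → mask b 0# ≈ 0#
  mask-0 true  = ≈-refl
  mask-0 false = ≈-refl

  mask-+ : ∀ b a a' → mask b (a + a') ≈ mask b a + mask b a'
  mask-+ true  a a' = ≈-refl
  mask-+ false a a' = ≈-sym (+-identityʳ 0#)

  mask-- : ∀ b a a' → mask b (a - a') ≈ mask b a - mask b a'
  mask-- true  a a' = ≈-refl
  mask-- false a a' = ≈-sym (x-x≈0 0#)

  mask-nonneg : ∀ b {a} → 0# ≤ a → 0# ≤ mask b a
  mask-nonneg true  p = p
  mask-nonneg false p = ≤-refl

  mask-≤ : ∀ b {a} → 0# ≤ a → mask b a ≤ a
  mask-≤ true  p = ≤-refl
  mask-≤ false p = p

  mask-mono : ∀ b {a a'} → a ≤ a' → mask b a ≤ mask b a'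
  mask-mono true  p = p
  mask-mono false p = ≤-refl

  sum-cong : ∀ {k} {f g : Fin k → Carrier} → (∀ i → f i ≈ g i) → sum f ≈ sum g
  sum-cong = sum-cong-≋

  sum-mono : ∀ {k} {f g : Fin k → Carrier} → (∀ i → f i ≤ g i) → sum f ≤ sum g
  sum-mono {zero}  p = ≤-refl
  sum-mono {suc k} p = +-mono-≤ (p zero) (sum-mono (λ i → p (suc i)))

  sum-zero : ∀ {k} {f : Fin k → Carrier} → (∀ i → f i ≈ 0#) → sum f ≈ 0#
  sum-zero {zero}  p = ≈-refl
  sum-zero {suc k} p = ≈-trans (+-cong (p zero) (sum-zero (λ i → p (suc i)))) (+-identityʳ 0#)

  sum-nonneg : ∀ {k} {f : Fin k → Carrier} → (∀ i → 0# ≤ f i) → 0# ≤ sum f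
  sum-nonneg {k} p = ≤-trans (reflexive (≈-sym (sum-zero {k} {λ _ → 0#} (λ _ → ≈-refl))))
                             (sum-mono p)

  sum-neg : ∀ {k} (f : Fin k → Carrier) → sum (λ i → - f i) ≈ - sum f
  sum-neg {zero}  f = ≈-sym -0≈0
  sum-neg {suc k} f = ≈-trans (+-congˡ (sum-neg (λ i → f (suc i)))) (≈-sym (-‿+ (f zero) _))

  sum-- : ∀ {k} (f g : Fin k → Carrier) → sum (λ i → f i - g i) ≈ sum f - sum g
  sum-- f g = ≈-trans (∑-distrib-+ f (λ i → - g i)) (+-congˡ (sum-neg g))

  sum-single : ∀ {k} {f : Fin k → Carrier} (a : Fin k) →
               (∀ i → ¬ i ≡ a → f i ≈ 0#) → sum f ≈ f a
  sum-single {suc k} {f} zero p =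
    ≈-trans (+-congˡ (sum-zero (λ i → p (suc i) (λ ())))) (+-identityʳ (f zero))
  sum-single {suc k} {f} (suc a) p = begin-equality
    f zero + sum (λ i → f (suc i)) ≈⟨ +-congʳ (p zero (λ ())) ⟩
    0# + sum (λ i → f (suc i))     ≈⟨ +-identityˡ _ ⟩
    sum (λ i → f (suc i))          ≈⟨ sum-single a (λ i i≢a → p (suc i) (i≢a ∘ suc-injective)) ⟩
    f (suc a)                      ∎

  mask-sum : ∀ {k} b (f : Fin k → Carrier) → mask b (sum f) ≈ sum (λ i → mask b (f i))
  mask-sum true  f = ≈-refl
  mask-sum {k} false f = ≈-sym (sum-zero {k} (λ _ → ≈-refl))

  sumOver : ∀ {k} → (Fin k → Bool) → (Fin k → Carrier) → Carrier
  sumOver P f = sum (λ i → mask (P i) (f i))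

  sumOver-resp : ∀ {k} {P Q : Fin k → Bool} (f : Fin k → Carrier) → P ≗ Q →
                 sumOver P f ≈ sumOver Q f
  sumOver-resp f eq = sum-cong (λ i → ≡⇒≈ (≡.cong (λ b → mask b (f i)) (eq i)))

  sumOver-+ : ∀ {k} P (f g : Fin k → Carrier) →
              sumOver P (λ i → f i + g i) ≈ sumOver P f + sumOver P g
  sumOver-+ P f g = ≈-trans (sum-cong (λ i → mask-+ (P i) (f i) (g i)))
                            (∑-distrib-+ (λ i → mask (P i) (f i)) (λ i → mask (P i) (g i)))

  sumOver-mono : ∀ {k} P {f g : Fin k → Carrier} → (∀ i → f i ≤ g i) → sumOver P f ≤ sumOver P g
  sumOver-mono P p = sum-mono (λ i → mask-mono (P i) (p i))

  sumOver-nonneg : ∀ {k} P {f : Fin k → Carrier} → (∀ i → 0# ≤ f i) → 0# ≤ sumOver P f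
  sumOver-nonneg P p = sum-nonneg (λ i → mask-nonneg (P i) (p i))

  point : ∀ {k} → Fin k → Carrier → Fin k → Carrier
  point a α i = mask ⌊ i ≟ a ⌋ α

  point-≢ : ∀ {k} {a i : Fin k} α → ¬ i ≡ a → point a α i ≈ 0#
  point-≢ {a = a} {i} α i≢a with i ≟ a
  ... | yes i≡a = ⊥-elim (i≢a i≡a)
  ... | no _    = ≈-refl

  point-≡ : ∀ {k} (a : Fin k) α → point a α a ≈ α
  point-≡ a α with a ≟ a
  ... | yes _   = ≈-refl
  ... | no a≢a  = ⊥-elim (a≢a ≡.refl)

  sumOver-point : ∀ {k} (P : Fin k → Bool) a α → sumOver P (point a α) ≈ mask (P a) α
  sumOver-point P a α =
    ≈-trans (sum-single a (λ i i≢a → ≈-trans (mask-cong (P i) (point-≢ α i≢a)) (mask-0 (P i))))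
            (mask-cong (P a) (point-≡ a α))

  sumOver-singleton : ∀ {k} (f : Fin k → Carrier) a → sumOver (λ i → ⌊ i ≟ a ⌋) f ≈ f a
  sumOver-singleton f a = ≈-trans (sum-single a (λ i i≢a → point-≢ (f i) i≢a)) (point-≡ a (f a))

  sumOver-complement : ∀ {k} (P : Fin k → Bool) f →
                       sum f ≈ sumOver P f + sumOver (λ i → not (P i)) f
  sumOver-complement P f =
    ≈-trans (sum-cong split) (∑-distrib-+ (λ i → mask (P i) (f i)) (λ i → mask (not (P i)) (f i)))
    where
    split : ∀ i → f i ≈ mask (P i) (f i) + mask (not (P i)) (f i)
    split i with P i
    ... | true  = ≈-sym (+-identityʳ _)
    ... | false = ≈-sym (+-identityˡ _)

  sumOver-point-- : ∀ {k} (P : Fin k → Bool) a b α →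
                    sumOver P (λ i → point a α i - point b α i) ≈ mask (P a) α - mask (P b) α
  sumOver-point-- P a b α = begin-equality
    sumOver P (λ i → point a α i - point b α i)
      ≈⟨ sum-cong (λ i → mask-- (P i) (point a α i) (point b α i)) ⟩
    sum (λ i → mask (P i) (point a α i) - mask (P i) (point b α i))
      ≈⟨ sum-- (λ i → mask (P i) (point a α i)) (λ i → mask (P i) (point b α i)) ⟩
    sumOver P (point a α) - sumOver P (point b α)
      ≈⟨ +-cong (sumOver-point P a α) (-‿cong (sumOver-point P b α)) ⟩
    mask (P a) α - mask (P b) α ∎

  mask-difference : ∀ p q α → mask p α - mask q α ≈ mask (p ∧ not q) α - mask (q ∧ not p) α
  mask-difference true  true  α = ≈-trans (x-x≈0 α) (≈-sym (x-x≈0 0#))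
  mask-difference true  false α = ≈-refl
  mask-difference false true  α = ≈-refl
  mask-difference false false α = ≈-refl

  sumOver-agree : ∀ {k} P {f g : Fin k → Carrier} →
                  (∀ i → P i ≡ true → f i ≈ g i) → sumOver P f ≈ sumOver P g
  sumOver-agree P {f} {g} agree = sum-cong on
    where
    on : ∀ i → mask (P i) (f i) ≈ mask (P i) (g i)
    on i with P i in eq
    ... | true  = agree i eq
    ... | false = ≈-refl

  sumOver-vanish : ∀ {k} P {f : Fin k → Carrier} → (∀ i → P i ≡ true → f i ≈ 0#) →
                   sumOver P f ≈ 0#
  sumOver-vanish P {f} vanish =
    ≈-trans (sumOver-agree P vanish) (sum-zero (λ i → mask-0 (P i)))

  sum-pair : ∀ {k} (f : Fin k → Carrier) (a b : Fin k) → ¬ a ≡ b →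
             (∀ i → ¬ i ≡ a → ¬ i ≡ b → f i ≈ 0#) → sum f ≈ f a + f b
  sum-pair f a b a≢b vanish = begin-equality
    sum f
      ≈⟨ sumOver-complement (λ i → ⌊ i ≟ a ⌋) f ⟩
    sumOver (λ i → ⌊ i ≟ a ⌋) f + sumOver (λ i → not ⌊ i ≟ a ⌋) f
      ≈⟨ +-cong (sumOver-singleton f a) (≈-trans (sum-single b away) atB) ⟩
    f a + f b ∎
    where
    away : ∀ i → ¬ i ≡ b → mask (not ⌊ i ≟ a ⌋) (f i) ≈ 0#
    away i i≢b with i ≟ a
    ... | yes _   = ≈-refl
    ... | no i≢a  = vanish i i≢a i≢b
    atB : mask (not ⌊ b ≟ a ⌋) (f b) ≈ f b
    atB with b ≟ a
    ... | yes b≡a = ⊥-elim (a≢b (≡.sym b≡a))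
    ... | no _    = ≈-refl

  sumOver-modular : ∀ {k} (P Q : Fin k → Bool) f →
                    sumOver P f + sumOver Q f
                      ≈ sumOver (λ i → P i ∧ Q i) f + sumOver (λ i → P i ∨ Q i) f
  sumOver-modular P Q f = begin-equality
    sumOver P f + sumOver Q f
      ≈⟨ ∑-distrib-+ (λ i → mask (P i) (f i)) (λ i → mask (Q i) (f i)) ⟨
    sum (λ i → mask (P i) (f i) + mask (Q i) (f i))
      ≈⟨ sum-cong (λ i → pointwise (P i) (Q i) (f i)) ⟩
    sum (λ i → mask (P i ∧ Q i) (f i) + mask (P i ∨ Q i) (f i))
      ≈⟨ ∑-distrib-+ (λ i → mask (P i ∧ Q i) (f i)) (λ i → mask (P i ∨ Q i) (f i)) ⟩
    sumOver (λ i → P i ∧ Q i) f + sumOver (λ i → P i ∨ Q i) f ∎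
    where
    pointwise : ∀ p q α → mask p α + mask q α ≈ mask (p ∧ q) α + mask (p ∨ q) α
    pointwise true  true  α = ≈-refl
    pointwise true  false α = +-comm α 0#
    pointwise false true  α = ≈-refl
    pointwise false false α = ≈-refl

  -- The edgewise form of submodularity of cut capacities.  The Booleans say
  -- whether head and tail of an edge lie in X and in T; the edge has weight α
  -- in one weighting and β ≤ α in the other, and β < α is only allowed when
  -- the head lies in both sets.
  boundary-submodular : ∀ p q p' q' α β → 0# ≤ β → β ≤ α → (β ≈ α ⊎ (p ≡ true × q ≡ true)) →
    mask ((p ∨ q) ∧ not (p' ∨ q')) α + mask ((p ∧ q) ∧ not (p' ∧ q')) β
      ≤ mask (p ∧ not p') β + mask (q ∧ not q') α
  boundary-submodular true  true  true  true  α β β≥0 β≤α h = ≤-refl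
  boundary-submodular true  true  true  false α β β≥0 β≤α h = +-mono-≤ ≤-refl β≤α
  boundary-submodular true  true  false true  α β β≥0 β≤α h = reflexive (+-comm 0# β)
  boundary-submodular true  true  false false α β β≥0 β≤α h = reflexive (+-comm α β)
  boundary-submodular true  false true  true  α β β≥0 β≤α h = ≤-refl
  boundary-submodular true  false true  false α β β≥0 β≤α h = ≤-refl
  boundary-submodular true  false false true  α β β≥0 β≤α h = +-mono-≤ β≥0 ≤-refl
  boundary-submodular true  false false false α β β≥0 β≤α (inj₁ β≈α) =
    +-mono-≤ (reflexive (≈-sym β≈α)) ≤-refl
  boundary-submodular true  false false false α β β≥0 β≤α (inj₂ (_ , ()))
  boundary-submodular false true  true  true  α β β≥0 β≤α h = ≤-refl
  boundary-submodular false true  true  false α β β≥0 β≤α h = +-mono-≤ ≤-refl (≤-trans β≥0 β≤α)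
  boundary-submodular false true  false true  α β β≥0 β≤α h = ≤-refl
  boundary-submodular false true  false false α β β≥0 β≤α h = reflexive (+-comm α 0#)
  boundary-submodular false false true  true  α β β≥0 β≤α h = ≤-refl
  boundary-submodular false false true  false α β β≥0 β≤α h = ≤-refl
  boundary-submodular false false false true  α β β≥0 β≤α h = ≤-refl
  boundary-submodular false false false false α β β≥0 β≤α h = ≤-refl

module Network {c ℓ₁ ℓ₂ : Level} (F : OrderedField c ℓ₁ ℓ₂) (D : Digraph) where
  open OrderedField F
  open FlowDefs F D
  open Digraph D
  open OrderedFieldFacts F

  excess : Weight → Vertex → Carrier
  excess w t = ϱ w ⟦ t ⟧ - δ w ⟦ t ⟧

  edge-excess : ∀ e α t → mask (enters ⟦ t ⟧ e) α - mask (leaves ⟦ t ⟧ e) α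
                          ≈ point (head e) α t - point (tail e) α t
  edge-excess e α t with t ≟ head e | t ≟ tail e
  ... | yes _ | yes _ = ≈-trans (x-x≈0 0#) (≈-sym (x-x≈0 α))
  ... | yes _ | no _  = ≈-refl
  ... | no _  | yes _ = ≈-refl
  ... | no _  | no _  = ≈-refl

  -- The total excess of the vertices of a set X is the net inflow into X:
  -- summing edge by edge, edges inside or outside X contribute nothing.
  excess-over-set : ∀ w X → sumOver X (excess w) ≈ ϱ w X - δ w X
  excess-over-set w X = begin-equality
    sumOver X (excess w)
      ≈⟨ sum-cong (λ t → ≈-trans (mask-cong (X t) (≈-sym (sum-- (inflow t) (outflow t))))
                                 (mask-sum (X t) (λ e → inflow t e - outflow t e))) ⟩
    sum (λ t → sum (λ e → mask (X t) (inflow t e - outflow t e)))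
      ≈⟨ ∑-comm (λ t e → mask (X t) (inflow t e - outflow t e)) ⟩
    sum (λ e → sumOver X (λ t → inflow t e - outflow t e))
      ≈⟨ sum-cong (λ e → sum-cong (λ t → mask-cong (X t) (edge-excess e (w e) t))) ⟩
    sum (λ e → sumOver X (λ t → point (head e) (w e) t - point (tail e) (w e) t))
      ≈⟨ sum-cong (λ e → ≈-trans (sumOver-point-- X (head e) (tail e) (w e))
                                 (mask-difference (X (head e)) (X (tail e)) (w e))) ⟩
    sum (λ e → mask (enters X e) (w e) - mask (leaves X e) (w e))
      ≈⟨ sum-- (λ e → mask (enters X e) (w e)) (λ e → mask (leaves X e) (w e)) ⟩
    ϱ w X - δ w X ∎
    where
    inflow outflow : Vertex → Edge → Carrier
    inflow  t e = mask (enters ⟦ t ⟧ e) (w e)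
    outflow t e = mask (leaves ⟦ t ⟧ e) (w e)

  -- Every edge has both ends in V, so the excesses sum to zero.
  total-excess : ∀ w → sum (excess w) ≈ 0#
  total-excess w = begin-equality
    sum (excess w)                     ≈⟨ excess-over-set w (λ _ → true) ⟩
    ϱ w (λ _ → true) - δ w (λ _ → true) ≈⟨ +-cong (sum-zero {m} (λ _ → ≈-refl))
                                                 (-‿cong (sum-zero {m} (λ _ → ≈-refl))) ⟩
    0# - 0#                            ≈⟨ x-x≈0 0# ⟩
    0#                                 ∎

  excess-+ : ∀ w w' t → excess (λ e → w e + w' e) t ≈ excess w t + excess w' t
  excess-+ w w' t =
    ≈-trans (+-cong (sumOver-+ (enters ⟦ t ⟧) w w') (-‿cong (sumOver-+ (leaves ⟦ t ⟧) w w')))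
            ([x+y]-[z+w]≈[x-z]+[y-w] _ _ _ _)

  excess-point : ∀ e α t → excess (point e α) t ≈ point (head e) α t - point (tail e) α t
  excess-point e α t =
    ≈-trans (+-cong (sumOver-point (enters ⟦ t ⟧) e α) (-‿cong (sumOver-point (leaves ⟦ t ⟧) e α)))
            (edge-excess e α t)

  excess-0 : ∀ t → excess (λ _ → 0#) t ≈ 0#
  excess-0 t = ≈-trans (+-cong (vanishes (enters ⟦ t ⟧)) (-‿cong (vanishes (leaves ⟦ t ⟧)))) (x-x≈0 0#)
    where
    vanishes : ∀ P → sumOver P (λ (_ : Edge) → 0#) ≈ 0#
    vanishes P = sum-zero (λ e → mask-0 (P e))

  Separates : Vertex → Vertex → Subset → Set
  Separates r u X = X u ≡ true × X r ≡ false

  amount-nonneg : ∀ r {w} → Nonneg w → 0# ≤ amount r w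
  amount-nonneg r w≥0 = sumOver-nonneg (leaves ⟦ r ⟧) w≥0

  module FlowExcess {r u w} (u≢r : ¬ u ≡ r) (flow : IsFlow r u w) where
    a : Carrier
    a = amount r w

    conserves : ∀ t → ¬ t ≡ r → ¬ t ≡ u → ϱ w ⟦ t ⟧ ≈ δ w ⟦ t ⟧
    conserves = proj₁ (proj₂ flow)

    nothing-enters-r : ϱ w ⟦ r ⟧ ≈ 0#
    nothing-enters-r = proj₁ (proj₂ (proj₂ flow))

    at-inner : ∀ t → ¬ t ≡ r → ¬ t ≡ u → excess w t ≈ 0#
    at-inner t t≢r t≢u = ≈-trans (+-congˡ (-‿cong (≈-sym (conserves t t≢r t≢u)))) (x-x≈0 _)

    at-source : excess w r ≈ - a
    at-source = ≈-trans (+-congʳ nothing-enters-r) (+-identityˡ (- a))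

    -- the amount leaving r arrives at u, since the excesses sum to zero
    at-sink : excess w u ≈ a
    at-sink = begin-equality
      excess w u     ≈⟨ x+y≈0⇒y≈-x (≈-trans (≈-sym (sum-pair (excess w) r u r≢u at-inner))
                                            (total-excess w)) ⟩
      - excess w r   ≈⟨ -‿cong at-source ⟩
      - - a          ≈⟨ -‿involutive a ⟩
      a              ∎
      where
      r≢u : ¬ r ≡ u
      r≢u r≡u = u≢r (≡.sym r≡u)

    excess-of-flow : ∀ t → excess w t ≈ point u a t - point r a t
    excess-of-flow t with t ≟ u | t ≟ r
    ... | yes ≡.refl | yes ≡.refl = ⊥-elim (u≢r ≡.refl)
    ... | yes ≡.refl | no _       = ≈-trans at-sink (≈-sym (x-0≈x a))
    ... | no _       | yes ≡.refl = ≈-trans at-source (≈-sym (+-identityˡ (- a)))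
    ... | no t≢u     | no t≢r     = ≈-trans (at-inner t t≢r t≢u) (≈-sym (x-x≈0 0#))

  weak-duality : ∀ {r u w} (cap : Weight) → ¬ u ≡ r → IsFlow r u w → w ≤ᵥ cap →
                 ∀ X → Separates r u X → amount r w ≤ ϱ cap X
  weak-duality {r} {u} {w} cap u≢r flow w≤cap X (u∈X , r∉X) = begin
    amount r w                              ≈⟨ x-0≈x _ ⟨
    amount r w - 0#                         ≈⟨ +-cong (mask-true _ u∈X) (-‿cong (mask-false _ r∉X)) ⟨
    mask (X u) (amount r w) - mask (X r) (amount r w)
      ≈⟨ sumOver-point-- X u r (amount r w) ⟨
    sumOver X (λ t → point u (amount r w) t - point r (amount r w) t)
      ≈⟨ sum-cong (λ t → mask-cong (X t) (excess-of-flow t)) ⟨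
    sumOver X (excess w)                    ≈⟨ excess-over-set w X ⟩
    ϱ w X - δ w X                           ≤⟨ x-nonneg≤x (sumOver-nonneg _ (proj₁ flow)) ⟩
    ϱ w X                                   ≤⟨ sumOver-mono (enters X) w≤cap ⟩
    ϱ cap X                                 ∎
    where open FlowExcess u≢r flow using (excess-of-flow)

  true≢false : ¬ true ≡ false
  true≢false ()

  tail-inside : ∀ {U e} → U (tail e) ≡ true → enters U e ≡ false
  tail-inside {U} {e} eq rewrite eq = ∧-zeroʳ (U (head e))

  head-outside : ∀ {U e} → U (head e) ≡ false → enters U e ≡ false
  head-outside eq rewrite eq = ≡.refl

  head-inside : ∀ {U e} → enters U e ≡ true → U (head e) ≡ true × U (tail e) ≡ false
  head-inside {U} {e} eq with U (head e) | U (tail e)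
  head-inside ≡.refl | true | false = ≡.refl , ≡.refl

  enters-resp : ∀ {X Y} → X ≗ Y → ∀ e → enters X e ≡ enters Y e
  enters-resp eq e = ≡.cong₂ (λ p q → p ∧ not q) (eq (head e)) (eq (tail e))

  _∪_ _∩_ : Subset → Subset → Subset
  (X ∪ Y) t = X t ∨ Y t
  (X ∩ Y) t = X t ∧ Y t

  ϱ-submodular-mixed : ∀ x y X T → Nonneg y → y ≤ᵥ x →
                       (∀ e → y e ≈ x e ⊎ (X (head e) ≡ true × T (head e) ≡ true)) →
                       ϱ x (X ∪ T) + ϱ y (X ∩ T) ≤ ϱ y X + ϱ x T
  ϱ-submodular-mixed x y X T y≥0 y≤x differ = begin
    ϱ x (X ∪ T) + ϱ y (X ∩ T)
      ≈⟨ ∑-distrib-+ (λ e → mask (enters (X ∪ T) e) (x e)) (λ e → mask (enters (X ∩ T) e) (y e)) ⟨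
    sum (λ e → mask (enters (X ∪ T) e) (x e) + mask (enters (X ∩ T) e) (y e))
      ≤⟨ sum-mono (λ e → boundary-submodular (X (head e)) (T (head e)) (X (tail e)) (T (tail e))
                                             (x e) (y e) (y≥0 e) (y≤x e) (differ e)) ⟩
    sum (λ e → mask (enters X e) (y e) + mask (enters T e) (x e))
      ≈⟨ ∑-distrib-+ (λ e → mask (enters X e) (y e)) (λ e → mask (enters T e) (x e)) ⟩
    ϱ y X + ϱ x T ∎

  ϱ-submodular : ∀ x X T → Nonneg x → ϱ x (X ∪ T) + ϱ x (X ∩ T) ≤ ϱ x X + ϱ x T
  ϱ-submodular x X T x≥0 = ϱ-submodular-mixed x x X T x≥0 (λ _ → ≤-refl) (λ _ → inj₁ ≈-refl)

  Demand : Set c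
  Demand = Vertex → Carrier

  GaleCondition : Weight → Demand → Set ℓ₂
  GaleCondition cap d = ∀ X → sumOver X d ≤ ϱ cap X

  Realisable : Weight → Demand → Set (c ⊔ ℓ₁ ⊔ ℓ₂)
  Realisable cap d = Σ Weight λ w → Nonneg w × w ≤ᵥ cap × (∀ t → excess w t ≈ d t)

  -- Without capacity Gale's condition forces all demands to vanish, and the
  -- zero flow meets them.
  gale-zero-capacity : ∀ cap d → (∀ e → cap e ≈ 0#) → sum d ≈ 0# → GaleCondition cap d →
                       Realisable cap d
  gale-zero-capacity cap d cap≈0 total gale =
    (λ _ → 0#) , (λ _ → ≤-refl) , (λ e → reflexive (≈-sym (cap≈0 e))) ,
    (λ t → ≈-trans (excess-0 t) (antisym (d≥0 t) (d≤0 t)))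
    where
    no-inflow : ∀ X → ϱ cap X ≈ 0#
    no-inflow X = sumOver-vanish (enters X) (λ e _ → cap≈0 e)

    only : Vertex → Subset
    only t i = ⌊ i ≟ t ⌋

    all-but : Vertex → Subset
    all-but t i = not ⌊ i ≟ t ⌋

    d≤0 : ∀ t → d t ≤ 0#
    d≤0 t = begin
      d t                    ≈⟨ sumOver-singleton d t ⟨
      sumOver (only t) d     ≤⟨ gale (only t) ⟩
      ϱ cap (only t)         ≈⟨ no-inflow (only t) ⟩
      0#                     ∎

    d≥0 : ∀ t → 0# ≤ d t
    d≥0 t = -‿anti-≤⁻ (begin
      - d t                  ≈⟨ -‿cong (sumOver-singleton d t) ⟨
      - sumOver (only t) d   ≈⟨ x+y≈0⇒y≈-x (≈-trans (≈-sym (sumOver-complement (only t) d)) total) ⟨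
      sumOver (all-but t) d  ≤⟨ gale (all-but t) ⟩
      ϱ cap (all-but t)      ≈⟨ no-inflow (all-but t) ⟩
      0#                     ≈⟨ -0≈0 ⟨
      - 0#                   ∎)

  -- Remove the edge e = (a → b) from the network,
  -- after sending along it the largest amount s by which some set Y entered by
  -- e falls short of its demand without e.  With the demands reduced
  -- accordingly, Gale's condition still holds in the smaller network.
  module RemoveEdge (e : Edge) (cap : Weight) (d : Demand) (cap≥0 : Nonneg cap)
                    (gale : GaleCondition cap d) where
    a b : Vertex
    a = tail e
    b = head e

    cap⁻ : Weight
    cap⁻ e' = mask (not ⌊ e' ≟ e ⌋) (cap e')

    cap⁻≥0 : Nonneg cap⁻
    cap⁻≥0 e' = mask-nonneg (not ⌊ e' ≟ e ⌋) (cap≥0 e')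

    cap-split : ∀ e' → cap e' ≈ cap⁻ e' + point e (cap e) e'
    cap-split e' with e' ≟ e
    ... | yes ≡.refl = ≈-sym (+-identityˡ _)
    ... | no _       = ≈-sym (+-identityʳ _)

    ϱ-cap : ∀ U → ϱ cap U ≈ ϱ cap⁻ U + mask (enters U e) (cap e)
    ϱ-cap U = ≈-trans (sumOver-agree (enters U) (λ e' _ → cap-split e'))
              (≈-trans (sumOver-+ (enters U) cap⁻ (point e (cap e)))
                       (+-congˡ (sumOver-point (enters U) e (cap e))))

    ϱ-cap-avoiding : ∀ U → enters U e ≡ false → ϱ cap U ≈ ϱ cap⁻ U
    ϱ-cap-avoiding U e∉in =
      ≈-trans (ϱ-cap U) (≈-trans (+-congˡ (mask-false _ e∉in)) (+-identityʳ _))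

    shortfall : Subset → Carrier
    shortfall Y = mask (enters Y e) (sumOver Y d - ϱ cap⁻ Y)

    shortfall-resp : ∀ X Y → X ≗ Y → shortfall X ≈ shortfall Y
    shortfall-resp X Y eq =
      ≈-trans (≡⇒≈ (≡.cong (λ p → mask p (sumOver X d - ϱ cap⁻ X)) (enters-resp eq e)))
              (mask-cong (enters Y e)
                         (+-cong (sumOver-resp d eq) (-‿cong (sumOver-resp cap⁻ (enters-resp eq)))))

    worst : Σ Subset λ Y → ∀ X → shortfall X ≤ shortfall Y
    worst = Maximise.argmax isTotalOrder n shortfall shortfall-resp

    Y* : Subset
    Y* = proj₁ worst

    s : Carrier
    s = shortfall Y*

    s≥0 : 0# ≤ s
    s≥0 = proj₂ worst (λ _ → false)

    shortfall-bound : ∀ X → enters X e ≡ true → sumOver X d - ϱ cap⁻ X ≤ s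
    shortfall-bound X e∈in = ≤-trans (reflexive (≈-sym (mask-true _ e∈in))) (proj₂ worst X)

    s≤cap : s ≤ cap e
    s≤cap = by-entry (enters Y* e) ≡.refl
      where
      by-entry : ∀ p → enters Y* e ≡ p → s ≤ cap e
      by-entry true e∈in = begin
        s                            ≈⟨ mask-true _ e∈in ⟩
        sumOver Y* d - ϱ cap⁻ Y*     ≤⟨ x≤y+z⇒x-z≤y (begin
          sumOver Y* d                 ≤⟨ gale Y* ⟩
          ϱ cap Y*                     ≈⟨ ϱ-cap Y* ⟩
          ϱ cap⁻ Y* + mask (enters Y* e) (cap e) ≈⟨ +-cong ≈-refl (mask-true _ e∈in) ⟩
          ϱ cap⁻ Y* + cap e            ≈⟨ +-comm _ _ ⟩
          cap e + ϱ cap⁻ Y*            ∎) ⟩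
        cap e                        ∎
      by-entry false e∉in = ≤-trans (reflexive (mask-false _ e∉in)) (cap≥0 e)

    d⁻ : Demand
    d⁻ t = d t + (point a s t - point b s t)

    sumOver-d⁻ : ∀ X → sumOver X d⁻ ≈ sumOver X d + (mask (X a) s - mask (X b) s)
    sumOver-d⁻ X = ≈-trans (sumOver-+ X d (λ t → point a s t - point b s t))
                           (+-congˡ (sumOver-point-- X a b s))

    total⁻ : sum d ≈ 0# → sum d⁻ ≈ 0#
    total⁻ total =
      ≈-trans (sumOver-d⁻ (λ _ → true)) (≈-trans (+-cong total (x-x≈0 s)) (+-identityʳ 0#))

    -- If Y* is entered by e and X is left by e, then Y* ∩ X and Y* ∪ X are
    -- not entered by e, so submodularity bounds their demands without e.
    crossing : ∀ X → X a ≡ true → X b ≡ false → enters Y* e ≡ true →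
               sumOver Y* d + sumOver X d ≤ ϱ cap⁻ Y* + ϱ cap⁻ X
    crossing X a∈X b∉X e∈in = begin
      sumOver Y* d + sumOver X d                   ≈⟨ sumOver-modular Y* X d ⟩
      sumOver (Y* ∩ X) d + sumOver (Y* ∪ X) d      ≤⟨ +-mono-≤ (gale (Y* ∩ X)) (gale (Y* ∪ X)) ⟩
      ϱ cap (Y* ∩ X) + ϱ cap (Y* ∪ X)
        ≈⟨ +-cong (ϱ-cap-avoiding (Y* ∩ X) (head-outside {Y* ∩ X} {e} b∉Y*∩X))
                  (ϱ-cap-avoiding (Y* ∪ X) (tail-inside {Y* ∪ X} {e} a∈Y*∪X)) ⟩
      ϱ cap⁻ (Y* ∩ X) + ϱ cap⁻ (Y* ∪ X)            ≈⟨ +-comm _ _ ⟩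
      ϱ cap⁻ (Y* ∪ X) + ϱ cap⁻ (Y* ∩ X)            ≤⟨ ϱ-submodular cap⁻ Y* X cap⁻≥0 ⟩
      ϱ cap⁻ Y* + ϱ cap⁻ X                         ∎
      where
      b∉Y*∩X : (Y* ∩ X) b ≡ false
      b∉Y*∩X = ≡.cong₂ _∧_ (proj₁ (head-inside {Y*} {e} e∈in)) b∉X
      a∈Y*∪X : (Y* ∪ X) a ≡ true
      a∈Y*∪X = ≡.cong₂ _∨_ (proj₂ (head-inside {Y*} {e} e∈in)) a∈X

    gale⁻ : GaleCondition cap⁻ d⁻
    gale⁻ X = ≤-trans (reflexive (sumOver-d⁻ X)) (by-ends (X a) (X b) ≡.refl ≡.refl)
      where
      e-avoids : enters X e ≡ false → ∀ α → sumOver X d + (α - α) ≤ ϱ cap⁻ X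
      e-avoids e∉in α = begin
        sumOver X d + (α - α)   ≈⟨ +-congˡ (x-x≈0 α) ⟩
        sumOver X d + 0#        ≈⟨ +-identityʳ _ ⟩
        sumOver X d             ≤⟨ gale X ⟩
        ϱ cap X                 ≈⟨ ϱ-cap-avoiding X e∉in ⟩
        ϱ cap⁻ X                ∎

      e-leaves : X a ≡ true → X b ≡ false → ∀ p → enters Y* e ≡ p → sumOver X d + s ≤ ϱ cap⁻ X
      e-leaves a∈X b∉X true e∈in = begin
        sumOver X d + s                              ≈⟨ +-congˡ (mask-true _ e∈in) ⟩
        sumOver X d + (sumOver Y* d - ϱ cap⁻ Y*)     ≤⟨ x+y≤z+w⇒y+[x-z]≤w (crossing X a∈X b∉X e∈in) ⟩
        ϱ cap⁻ X                                     ∎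
      e-leaves a∈X b∉X false e∉in = begin
        sumOver X d + s         ≈⟨ +-congˡ (mask-false _ e∉in) ⟩
        sumOver X d + 0#        ≈⟨ +-identityʳ _ ⟩
        sumOver X d             ≤⟨ gale X ⟩
        ϱ cap X                 ≈⟨ ϱ-cap-avoiding X (tail-inside {X} {e} a∈X) ⟩
        ϱ cap⁻ X                ∎

      by-ends : ∀ p q → X a ≡ p → X b ≡ q → sumOver X d + (mask p s - mask q s) ≤ ϱ cap⁻ X
      by-ends true  true  a∈X _   = e-avoids (tail-inside {X} {e} a∈X) s
      by-ends false false _   b∉X = e-avoids (head-outside {X} {e} b∉X) 0#
      by-ends true  false a∈X b∉X =
        ≤-trans (reflexive (+-congˡ (x-0≈x s))) (e-leaves a∈X b∉X (enters Y* e) ≡.refl)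
      by-ends false true  a∉X b∈X = begin
        sumOver X d + (0# - s)  ≈⟨ +-congˡ (+-identityˡ (- s)) ⟩
        sumOver X d - s         ≤⟨ x≤y+z⇒x-z≤y (≤-trans (x-z≤y⇒x≤y+z (shortfall-bound X e∈in))
                                                        (reflexive (+-comm s _))) ⟩
        ϱ cap⁻ X                ∎
        where
        e∈in : enters X e ≡ true
        e∈in = ≡.cong₂ (λ p q → q ∧ not p) a∉X b∈X

    extend : Realisable cap⁻ d⁻ → Realisable cap d
    extend (w , w≥0 , w≤cap⁻ , meets) = w⁺ , w⁺≥0 , w⁺≤cap , meets⁺
      where
      w⁺ : Weight
      w⁺ e' = w e' + point e s e'

      w⁺≥0 : Nonneg w⁺
      w⁺≥0 e' = nonneg-+ (w≥0 e') (mask-nonneg ⌊ e' ≟ e ⌋ s≥0)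

      w⁺≤cap : w⁺ ≤ᵥ cap
      w⁺≤cap e' = ≤-trans (+-mono-≤ (w≤cap⁻ e') (mask-mono ⌊ e' ≟ e ⌋ s≤cap))
                          (reflexive (≈-sym (cap-split e')))

      meets⁺ : ∀ t → excess w⁺ t ≈ d t
      meets⁺ t = begin-equality
        excess w⁺ t                                         ≈⟨ excess-+ w (point e s) t ⟩
        excess w t + excess (point e s) t                   ≈⟨ +-cong (meets t) (excess-point e s t) ⟩
        d t + (point a s t - point b s t) + (point b s t - point a s t) ≈⟨ x+[y-z]+[z-y]≈x _ _ _ ⟩
        d t                                                 ∎

  gale-supported : ∀ (L : List Edge) cap d → Nonneg cap → (∀ e → ¬ e ∈ L → cap e ≈ 0#) →
                   sum d ≈ 0# → GaleCondition cap d → Realisable cap d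
  gale-supported []      cap d cap≥0 support total gale =
    gale-zero-capacity cap d (λ e → support e (λ ())) total gale
  gale-supported (e ∷ L) cap d cap≥0 support total gale =
    extend (gale-supported L cap⁻ d⁻ cap⁻≥0 support⁻ (total⁻ total) gale⁻)
    where
    open RemoveEdge e cap d cap≥0 gale
    support⁻ : ∀ e' → ¬ e' ∈ L → cap⁻ e' ≈ 0#
    support⁻ e' e'∉L with e' ≟ e
    ... | yes _    = ≈-refl
    ... | no e'≢e  = support e' λ { (here e'≡e) → e'≢e e'≡e ; (there e'∈L) → e'∉L e'∈L }

  gale-theorem : ∀ cap d → Nonneg cap → sum d ≈ 0# → GaleCondition cap d → Realisable cap d
  gale-theorem cap d cap≥0 =
    gale-supported (allFin m) cap d cap≥0 (λ e e∉E → ⊥-elim (e∉E (∈-allFin e)))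

  -- Max-flow min-cut, in the direction needed here: an amount α ≥ 0 that every
  -- r-u cut can carry is the amount of some r → u flow.  Block the edges
  -- entering r or leaving u, and let Gale's theorem produce excess α at u and
  -- -α at r.
  module MaxFlow {r u : Vertex} (u≢r : ¬ u ≡ r) {cap : Weight} (cap≥0 : Nonneg cap)
                 {α : Carrier} (α≥0 : 0# ≤ α) (cuts : ∀ X → Separates r u X → α ≤ ϱ cap X) where
    blocked : Edge → Bool
    blocked e = enters ⟦ r ⟧ e ∨ leaves ⟦ u ⟧ e

    cap° : Weight
    cap° e = mask (not (blocked e)) (cap e)

    cut-unblocked : ∀ X → Separates r u X → ∀ e → enters X e ≡ true → blocked e ≡ false
    cut-unblocked X (u∈X , r∉X) e e∈in with head-inside {X} {e} e∈in | r ≟ head e | u ≟ tail e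
    ... | head∈X , _       | yes r≡head | _          =
      ⊥-elim (true≢false (≡.trans (≡.sym head∈X) (≡.trans (≡.cong X (≡.sym r≡head)) r∉X)))
    ... | _      , tail∉X  | no _       | yes u≡tail =
      ⊥-elim (true≢false (≡.trans (≡.sym u∈X) (≡.trans (≡.cong X u≡tail) tail∉X)))
    ... | _      , _       | no _       | no _       = ≡.refl

    d : Demand
    d t = point u α t - point r α t

    gale : GaleCondition cap° d
    gale X = ≤-trans (reflexive (sumOver-point-- X u r α)) (by-ends (X u) (X r) ≡.refl ≡.refl)
      where
      inflow≥0 : 0# ≤ ϱ cap° X
      inflow≥0 = sumOver-nonneg (enters X) (λ e → mask-nonneg (not (blocked e)) (cap≥0 e))

      by-ends : ∀ p q → X u ≡ p → X r ≡ q → mask p α - mask q α ≤ ϱ cap° X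
      by-ends true  false u∈X r∉X = begin
        α - 0#     ≈⟨ x-0≈x α ⟩
        α          ≤⟨ cuts X (u∈X , r∉X) ⟩
        ϱ cap X    ≈⟨ sumOver-agree (enters X) unblocked ⟩
        ϱ cap° X   ∎
        where
        unblocked : ∀ e → enters X e ≡ true → cap e ≈ cap° e
        unblocked e e∈in =
          ≈-sym (mask-true (cap e) (≡.cong not (cut-unblocked X (u∈X , r∉X) e e∈in)))
      by-ends true  true  _ _ = ≤-trans (reflexive (x-x≈0 α)) inflow≥0
      by-ends false true  _ _ =
        ≤-trans (≤-trans (reflexive (+-identityˡ (- α))) (nonneg⇒-≤0 α≥0)) inflow≥0
      by-ends false false _ _ = ≤-trans (reflexive (x-x≈0 0#)) inflow≥0

    flow : Σ Weight λ w → IsFlow r u w × w ≤ᵥ cap × amount r w ≈ α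
    flow with gale-theorem cap° d (λ e → mask-nonneg (not (blocked e)) (cap≥0 e))
                           (≈-trans (sumOver-point-- (λ _ → true) u r α) (x-x≈0 α)) gale
    ... | w , w≥0 , w≤cap° , meets =
      w , (w≥0 , conservation , no-return , no-overshoot) , w≤cap , amount≈α
      where
      w≤cap : w ≤ᵥ cap
      w≤cap e = ≤-trans (w≤cap° e) (mask-≤ (not (blocked e)) (cap≥0 e))

      unused : ∀ e → blocked e ≡ true → w e ≈ 0#
      unused e blocked =
        antisym (≤-trans (w≤cap° e) (reflexive (mask-false (cap e) (≡.cong not blocked)))) (w≥0 e)

      no-return : ϱ w ⟦ r ⟧ ≈ 0#
      no-return = sumOver-vanish (enters ⟦ r ⟧)
        (λ e into-r → unused e (≡.cong (_∨ leaves ⟦ u ⟧ e) into-r))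

      no-overshoot : δ w ⟦ u ⟧ ≈ 0#
      no-overshoot = sumOver-vanish (leaves ⟦ u ⟧)
        (λ e out-of-u → unused e (≡.trans (≡.cong (enters ⟦ r ⟧ e ∨_) out-of-u) (∨-zeroʳ _)))

      conservation : ∀ t → ¬ t ≡ r → ¬ t ≡ u → ϱ w ⟦ t ⟧ ≈ δ w ⟦ t ⟧
      conservation t t≢r t≢u = x-y≈0⇒x≈y (≈-trans (meets t)
        (≈-trans (+-cong (point-≢ α t≢u) (-‿cong (point-≢ α t≢r))) (x-x≈0 0#)))

      amount≈α : amount r w ≈ α
      amount≈α = -‿injective (begin-equality
        - δ w ⟦ r ⟧               ≈⟨ +-identityˡ _ ⟨
        0# - δ w ⟦ r ⟧            ≈⟨ +-congʳ no-return ⟨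
        excess w r                ≈⟨ meets r ⟩
        point u α r - point r α r ≈⟨ +-cong (point-≢ α (u≢r ∘ ≡.sym)) (-‿cong (point-≡ r α)) ⟩
        0# - α                    ≈⟨ +-identityˡ (- α) ⟩
        - α                       ∎)

  -- Among the r-v cuts there is one of minimum capacity: minimise over all
  -- subsets after forcing v in and r out.
  minimum-cut : ∀ {r v} → ¬ v ≡ r → (cap : Weight) →
                Σ Subset λ T → Separates r v T × (∀ X → Separates r v X → ϱ cap T ≤ ϱ cap X)
  minimum-cut {r} {v} v≢r cap = force Y₀ , (v∈T , r∉T) , minimal
    where
    force : Subset → Subset
    force Y t = ⟦ v ⟧ t ∨ (not (⟦ r ⟧ t) ∧ Y t)

    force-resp : ∀ X Y → X ≗ Y → ϱ cap (force X) ≈ ϱ cap (force Y)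
    force-resp X Y eq =
      sumOver-resp cap (enters-resp (λ t → ≡.cong (λ p → ⟦ v ⟧ t ∨ (not (⟦ r ⟧ t) ∧ p)) (eq t)))

    force-cut : ∀ X → Separates r v X → force X ≗ X
    force-cut X (v∈X , r∉X) t with v ≟ t | r ≟ t
    ... | yes ≡.refl | _          = ≡.sym v∈X
    ... | no _       | yes ≡.refl = ≡.sym r∉X
    ... | no _       | no _       = ≡.refl

    -- minimisation is maximisation for the reversed order
    smallest : Σ Subset λ Y → ∀ X → ϱ cap (force Y) ≤ ϱ cap (force X)
    smallest = Maximise.argmax (Flip.isTotalOrder isTotalOrder) n (λ Y → ϱ cap (force Y)) force-resp

    Y₀ : Subset
    Y₀ = proj₁ smallest

    v∈T : force Y₀ v ≡ true
    v∈T with v ≟ v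
    ... | yes _   = ≡.refl
    ... | no v≢v  = ⊥-elim (v≢v ≡.refl)

    r∉T : force Y₀ r ≡ false
    r∉T with v ≟ r | r ≟ r
    ... | yes v≡r | _      = ⊥-elim (v≢r v≡r)
    ... | no _    | yes _  = ≡.refl
    ... | no _    | no r≢r = ⊥-elim (r≢r ≡.refl)

    minimal : ∀ X → Separates r v X → ϱ cap (force Y₀) ≤ ϱ cap X
    minimal X cut =
      ≤-trans (proj₂ smallest X) (reflexive (sumOver-resp cap (enters-resp (force-cut X cut))))

  same-max-flow-value : ∀ {r u x y μ} → y ≤ᵥ x →
    (∀ w → IsFlow r u w → w ≤ᵥ x →
           Σ Weight λ w' → IsFlow r u w' × w' ≤ᵥ y × amount r w' ≈ amount r w) →
    IsMaxFlowValue r y u μ ⇔ IsMaxFlowValue r x u μ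
  same-max-flow-value {r} {u} {x} {y} {μ} y≤x reroute = mk⇔ to from
    where
    to : IsMaxFlowValue r y u μ → IsMaxFlowValue r x u μ
    to ((w , flow , w≤y , w-amount) , bound) =
      (w , flow , (λ e → ≤-trans (w≤y e) (y≤x e)) , w-amount) ,
      λ w' flow' w'≤x → let (w'' , flow'' , w''≤y , same) = reroute w' flow' w'≤x in
                        ≤-trans (reflexive (≈-sym same)) (bound w'' flow'' w''≤y)

    from : IsMaxFlowValue r x u μ → IsMaxFlowValue r y u μ
    from ((w , flow , w≤x , w-amount) , bound) =
      (let (w' , flow' , w'≤y , same) = reroute w flow w≤x
       in w' , flow' , w'≤y , ≈-trans same w-amount) ,
      λ w' flow' w'≤y → bound w' flow' (λ e → ≤-trans (w'≤y e) (y≤x e))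

  module RestrictIn {r v} (v≢r : ¬ v ≡ r) {x} (x≥0 : Nonneg x) {z} (z-flow : IsFlow r v z)
                    (z≤x : z ≤ᵥ x) (z-max : IsMaxFlowValue r x v (amount r z)) where
    y : Weight
    y = restrictIn v z x

    y≤x : y ≤ᵥ x
    y≤x e with enters ⟦ v ⟧ e
    ... | true  = z≤x e
    ... | false = ≤-refl

    y≥0 : Nonneg y
    y≥0 e with enters ⟦ v ⟧ e
    ... | true  = proj₁ z-flow e
    ... | false = x≥0 e

    z≤y : z ≤ᵥ y
    z≤y e with enters ⟦ v ⟧ e
    ... | true  = ≤-refl
    ... | false = z≤x e

    y-differs : ∀ e → y e ≈ x e ⊎ head e ≡ v
    y-differs e with v ≟ head e
    ... | yes v≡head = inj₂ (≡.sym v≡head)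
    ... | no _       = inj₁ ≈-refl

    T : Subset
    T = proj₁ (minimum-cut v≢r x)

    v∈T : T v ≡ true
    v∈T = proj₁ (proj₁ (proj₂ (minimum-cut v≢r x)))

    r∉T : T r ≡ false
    r∉T = proj₂ (proj₁ (proj₂ (minimum-cut v≢r x)))

    T-minimal : ∀ X → Separates r v X → ϱ x T ≤ ϱ x X
    T-minimal = proj₂ (proj₂ (minimum-cut v≢r x))

    -- A flow carries the capacity of the minimum cut T, and z is a maximum flow.
    T-tight : ϱ x T ≤ amount r z
    T-tight = carried (MaxFlow.flow v≢r x≥0 (sumOver-nonneg (enters T) x≥0) T-minimal)
      where
      carried : (Σ Weight λ w → IsFlow r v w × w ≤ᵥ x × amount r w ≈ ϱ x T) → ϱ x T ≤ amount r z
      carried (w , w-flow , w≤x , w-amount) =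
        ≤-trans (reflexive (≈-sym w-amount)) (proj₂ z-max w w-flow w≤x)

    -- If v ∉ X, then y and x agree on the edges entering X.  If v ∈ X, weak
    -- duality on X ∪ T and X ∩ T and submodularity give the bound, after
    -- cancelling ϱ x T.
    cut-bound : ∀ {u w} → ¬ u ≡ r → IsFlow r u w → w ≤ᵥ x →
                ∀ X → Separates r u X → amount r w ≤ ϱ y X
    cut-bound {u} {w} u≢r w-flow w≤x X (u∈X , r∉X) = by-v (X v) ≡.refl
      where
      by-v : ∀ p → X v ≡ p → amount r w ≤ ϱ y X
      by-v false v∉X = begin
        amount r w   ≤⟨ weak-duality x u≢r w-flow w≤x X (u∈X , r∉X) ⟩
        ϱ x X        ≈⟨ sumOver-agree (enters X) agree ⟩
        ϱ y X        ∎
        where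
        agree : ∀ e → enters X e ≡ true → x e ≈ y e
        agree e e∈in with y-differs e
        ... | inj₁ y≈x     = ≈-sym y≈x
        ... | inj₂ head≡v  = ⊥-elim (true≢false (≡.trans (≡.sym head∈X) (≡.trans (≡.cong X head≡v) v∉X)))
          where
          head∈X : X (head e) ≡ true
          head∈X = proj₁ (head-inside {X} {e} e∈in)
      by-v true v∈X = +-cancelʳ-≤ (ϱ x T) (begin
        amount r w + ϱ x T
          ≤⟨ +-mono-≤ (weak-duality x u≢r w-flow w≤x (X ∪ T) X∪T-cut)
                      (≤-trans T-tight (weak-duality y v≢r z-flow z≤y (X ∩ T) X∩T-cut)) ⟩
        ϱ x (X ∪ T) + ϱ y (X ∩ T)   ≤⟨ ϱ-submodular-mixed x y X T y≥0 y≤x differ ⟩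
        ϱ y X + ϱ x T               ∎)
        where
        X∪T-cut : Separates r u (X ∪ T)
        X∪T-cut = ≡.cong (_∨ T u) u∈X , ≡.cong₂ _∨_ r∉X r∉T
        X∩T-cut : Separates r v (X ∩ T)
        X∩T-cut = ≡.cong₂ _∧_ v∈X v∈T , ≡.cong (_∧ T r) r∉X
        differ : ∀ e → y e ≈ x e ⊎ (X (head e) ≡ true × T (head e) ≡ true)
        differ e with y-differs e
        ... | inj₁ y≈x    = inj₁ y≈x
        ... | inj₂ head≡v = inj₂ (≡.trans (≡.cong X head≡v) v∈X , ≡.trans (≡.cong T head≡v) v∈T)

    reroute : ∀ {u} → ¬ u ≡ r → ∀ w → IsFlow r u w → w ≤ᵥ x →
              Σ Weight λ w' → IsFlow r u w' × w' ≤ᵥ y × amount r w' ≈ amount r w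
    reroute u≢r w w-flow w≤x =
      MaxFlow.flow u≢r y≥0 (amount-nonneg r (proj₁ w-flow)) (cut-bound u≢r w-flow w≤x)

lemma6 : ∀ {c ℓ₁ ℓ₂ : Level} (F : OrderedField c ℓ₁ ℓ₂) (D : Digraph) →
           let open OrderedField F
               open FlowDefs F D
           in (r v : Vertex) → ¬ (v ≡ r) →
              (x : Weight) → Nonneg x →
              (z : Weight) → IsFlow r v z → z ≤ᵥ x →
              IsMaxFlowValue r x v (amount r z) →
              (u : Vertex) → ¬ (u ≡ r) → (μ : Carrier) →
              IsMaxFlowValue r (restrictIn v z x) u μ ⇔ IsMaxFlowValue r x u μ
lemma6 F D r v v≢r x x≥0 z z-flow z≤x z-max u u≢r μ =
  same-max-flow-value y≤x (reroute u≢r)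
  where
  open Network F D
  open RestrictIn v≢r x≥0 z-flow z≤x z-max
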